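{- For every $0,1$-matrix $A$, $R(\mathcal{S}_A)=\mathrm{R}_{\mathbb{B}}(A)$.
   Context: A spanoid $\mathcal{S}$ over a finite set $U$ is a family of pairs $(S,i)$ with $S\subseteq U$, $i\in U$ (read "$S$ spans $i$"); it is assumed that $(\{i\},i)\in\mathcal{S}$ for all $i\in U$ and that $(S,i)\in\mathcal{S}$ implies $(S',i)\in\mathcal{S}$ whenever $S\subseteq S'\subseteq U$. A derivation of $i$ from $T\subseteq U$ is a sequence $T=T_0,T_1,\ldots,T_r\subseteq U$ with $i\in T_r$ such that each $T_j=T_{j-1}\cup\{i_j\}$ where $(S,i_j)\in\mathcal{S}$ for some $S\subseteq T_{j-1}$. The span of $T$ is the set of $i\in U$ derivable from $T$. The rank $R(\mathcal{S})$ is the minimum size of a set $S\subseteq U$ whose span is $U$. For a $0,1$-matrix $A$, $U_A$ is the set of all $0,1$-matrices $M$ of Boolean rank $1$ with $M\preceq A$ (entrywise $\le$), and $\mathcal{S}_A$ is the spanoid over $U_A$ in which $S\subseteq U_A$ spans $M\in U_A$ iff every nonzero entry of $M$ is nonzero in at least one matrix of $S$. $\mathrm{R}_{\mathbb{B}}(A)$ is the Boolean rank: the smallest number of all-ones combinatorial rectangles needed to cover the $1$-entries of $A$. -}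

module Defs where

open import Data.Nat using (ℕ; _≤_)
open import Data.Fin using (Fin)
open import Data.Bool using (Bool; true; false)
open import Data.List using (List; []; _∷_; [_]; length)
open import Data.List.Membership.Propositional using (_∈_)
open import Data.List.Relation.Unary.Any using (Any; here; there)
open import Data.List.Relation.Unary.All using (All)
open import Data.List.Relation.Binary.Subset.Propositional using (_⊆_)
open import Data.Product using (Σ; _×_; _,_)
open import Relation.Binary.PropositionalEquality using (_≡_; refl)

-- Spanoids over a (finite) carrier type U.
-- Finite subsets of U are represented by lists of elements of U.

record Spanoid (U : Set) : Set₁ where
  field
    Spans   : List U → U → Set           -- (S , i) ∈ 𝒮  ,  "S spans i"
    spans-refl : ∀ i → Spans [ i ] i
    spans-mono : ∀ {S S′ i} → S ⊆ S′ → Spans S i → Spans S′ i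

module _ {U : Set} (𝒮 : Spanoid U) where
  open Spanoid 𝒮

  -- Derivation of i from T: T = T₀, T₁ = T₀ ∪ {i₁}, … , with i ∈ T_r,
  -- where each added i_j is spanned by some S ⊆ T_{j-1}.
  data Derivation (T : List U) (i : U) : Set where
    done : i ∈ T → Derivation T i
    step : (j : U) (S : List U) → S ⊆ T → Spans S j →
           Derivation (j ∷ T) i → Derivation T i

  SpansAll : List U → Set
  SpansAll T = ∀ i → Derivation T i

  IsSpanoidRank : ℕ → Set
  IsSpanoidRank r =
    Σ (List U) (λ T → SpansAll T × length T ≡ r) ×
    (∀ T → SpansAll T → r ≤ length T)

Matrix : ℕ → ℕ → Set
Matrix m n = Fin m → Fin n → Bool

_⪯_ : ∀ {m n} → Matrix m n → Matrix m n → Set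
M ⪯ A = ∀ r c → M r c ≡ true → A r c ≡ true

Rectangle : ℕ → ℕ → Set
Rectangle m n = (Fin m → Bool) × (Fin n → Bool)

InRect : ∀ {m n} → Rectangle m n → Fin m → Fin n → Set
InRect (R , C) r c = (R r ≡ true) × (C c ≡ true)

AllOnes : ∀ {m n} → Matrix m n → Rectangle m n → Set
AllOnes A ρ = ∀ r c → InRect ρ r c → A r c ≡ true

IsCover : ∀ {m n} → Matrix m n → List (Rectangle m n) → Set
IsCover A ρs = All (AllOnes A) ρs × (∀ r c → A r c ≡ true → Any (λ ρ → InRect ρ r c) ρs)

IsBoolRank : ∀ {m n} → Matrix m n → ℕ → Set
IsBoolRank A k =
  Σ (List _) (λ ρs → IsCover A ρs × length ρs ≡ k) ×
  (∀ ρs → IsCover A ρs → k ≤ length ρs)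

-- elements of U_A: matrices M with Boolean rank 1 and M ⪯ A
-- (the membership proof is irrelevant, so elements are determined by M)
record UA {m n} (A : Matrix m n) : Set where
  constructor ⟨_,_⟩
  field
    mat : Matrix m n
    .isElem : IsBoolRank mat 1 × mat ⪯ A
open UA public

SpansA : ∀ {m n} {A : Matrix m n} → List (UA A) → UA A → Set
SpansA S M = ∀ r c → mat M r c ≡ true → Any (λ N → mat N r c ≡ true) S

𝒮 : ∀ {m n} (A : Matrix m n) → Spanoid (UA A)
𝒮 A = record
  { Spans = SpansA
  ; spans-refl = λ i r c e → here e
  ; spans-mono = λ S⊆S′ sp r c e → mono S⊆S′ (sp r c e)
  }
  where
  mono : ∀ {S S′ : List (UA A)} {P : UA A → Set} → S ⊆ S′ → Any P S → Any P S′
  mono {S′ = S′} {P} sub (here {x = x} p) = anyIn (sub (here refl)) p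
    where
    anyIn : ∀ {y ys} → y ∈ ys → P y → Any P ys
    anyIn (here refl) q = here q
    anyIn (there w) q = there (anyIn w q)
  mono sub (there a) = mono (λ w → sub (there w)) a

-- A set T spanning U_A gives a cover of A by the supports of its members:
-- a 1-entry (r , c) of A is a 1 of the row rectangle {r} × A_r ∈ U_A, which T must
-- derive, and derivations in 𝒮_A never create new 1-entries.  Conversely, the
-- nonempty rectangles of a cover lie in U_A and span every element in a single step.
-- So both minima are taken over sets of the same sizes; the minimum defining the
-- Boolean rank exists because covers of a given size can be searched exhaustively.
module Submission where

open import Defs
open import Data.Nat using (ℕ)
open import Data.Product using (Σ; _×_)

open import Level using (0ℓ)
open import Function using (_∘_; id)
open import Data.Bool using (Bool; true; _∧_)
open import Data.Bool.Properties using (_≟_)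
open import Data.Nat using (zero; suc; _≤_; _<_; z≤n; s≤s)
open import Data.Nat.Properties using (≤-antisym; m≤n⇒m≤1+n; ≮⇒≥; suc-injective; anyUpTo?)
open import Data.Nat.Induction using (<-rec)
open import Data.Fin using (Fin)
import Data.Fin as Fin
open import Data.Fin.Properties using (any?; all?)
open import Data.Fin.Subset using (Subset)
open import Data.Fin.Subset.Properties using (anySubset?)
open import Data.Vec using (lookup; tabulate)
open import Data.Vec.Properties using (lookup∘tabulate)
open import Data.List using (List; []; _∷_; length; map; allFin)
open import Data.List.Properties using (length-map; map-∘)
open import Data.List.Membership.Propositional using (lose)
open import Data.List.Membership.Propositional.Properties using (∈-allFin)
open import Data.List.Relation.Binary.Subset.Propositional.Properties using (Any-resp-⊆)
open import Data.List.Relation.Unary.Any as Any using (Any; here; there)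
import Data.List.Relation.Unary.Any.Properties as Any
open import Data.List.Relation.Unary.All as All using (All; []; _∷_)
import Data.List.Relation.Unary.All.Properties as All
open import Data.Product using (∃; _,_; proj₁; proj₂)
open import Relation.Nullary using (Dec; yes; no; does; contradiction)
open import Relation.Nullary.Decidable using (dec-true; map′; _×-dec_; _→-dec_; recompute)
open import Relation.Unary using (Pred; Decidable)
open import Relation.Binary.PropositionalEquality using (_≡_; refl; sym; trans; cong; subst)

fromDoes : ∀ {P : Set} (P? : Dec P) → does P? ≡ true → P
fromDoes (yes p) _ = p
fromDoes (no _) ()

∧-intro : ∀ {a b} → a ≡ true → b ≡ true → a ∧ b ≡ true
∧-intro refl refl = refl

∧-elim : ∀ {a b} → a ∧ b ≡ true → a ≡ true × b ≡ true
∧-elim {true} {true} refl = refl , refl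

Least : Pred ℕ 0ℓ → Set
Least P = Σ ℕ λ b → P b × (∀ k → P k → b ≤ k)

least : ∀ {P : Pred ℕ 0ℓ} → Decidable P → ∀ n → P n → Least P
least {P} P? = <-rec (λ n → P n → Least P) search
  where
  search : ∀ n → (∀ {k} → k < n → P k → Least P) → P n → Least P
  search n below Pn with anyUpTo? P? n
  ... | yes (k , k<n , Pk) = below k<n Pk
  ... | no none = n , Pn , λ k Pk → ≮⇒≥ λ k<n → none (k , k<n , Pk)

Searchable : Set → Set₁
Searchable X = ∀ {P : Pred X 0ℓ} → Decidable P → Dec (∃ P)

×-searchable : ∀ {X Y} → Searchable X → Searchable Y → Searchable (X × Y)
×-searchable search-X search-Y P? =
  map′ (λ (x , y , p) → (x , y) , p) (λ ((x , y) , p) → x , y , p)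
       (search-X λ x → search-Y λ y → P? (x , y))

ofLength? : ∀ {X} → Searchable X → ∀ k {P : Pred (List X) 0ℓ} → Decidable P →
            Dec (∃ λ xs → length xs ≡ k × P xs)
ofLength? search zero P? =
  map′ (λ p → [] , refl , p) (λ { ([] , _ , p) → p ; (_ ∷ _ , () , _) }) (P? [])
ofLength? search (suc k) P? =
  map′ (λ (x , xs , len , p) → x ∷ xs , cong suc len , p)
       (λ { (x ∷ xs , len , p) → x , xs , suc-injective len , p ; ([] , () , _) })
       (search λ x → ofLength? search k (P? ∘ (x ∷_)))

singleton : ∀ {k} → Fin k → Fin k → Bool
singleton i j = does (i Fin.≟ j)

singleton-refl : ∀ {k} (i : Fin k) → singleton i i ≡ true
singleton-refl i = dec-true (i Fin.≟ i) refl

singleton-≡ : ∀ {k} {i j : Fin k} → singleton i j ≡ true → i ≡ j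
singleton-≡ {i = i} {j} = fromDoes (i Fin.≟ j)

anyTrue : ∀ {k} → (Fin k → Bool) → Bool
anyTrue f = does (any? λ i → f i ≟ true)

anyTrue⁺ : ∀ {k} (f : Fin k → Bool) {i} → f i ≡ true → anyTrue f ≡ true
anyTrue⁺ f {i} e = dec-true (any? λ i → f i ≟ true) (i , e)

anyTrue⁻ : ∀ {k} (f : Fin k → Bool) → anyTrue f ≡ true → ∃ λ i → f i ≡ true
anyTrue⁻ f = fromDoes (any? λ i → f i ≟ true)

module _ {m n : ℕ} where

  rectMatrix : Rectangle m n → Matrix m n
  rectMatrix (R , C) r c = R r ∧ C c

  rectMatrix⁺ : ∀ ρ {r c} → InRect ρ r c → rectMatrix ρ r c ≡ true
  rectMatrix⁺ _ (inR , inC) = ∧-intro inR inC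

  rectMatrix⁻ : ∀ ρ {r c} → rectMatrix ρ r c ≡ true → InRect ρ r c
  rectMatrix⁻ _ = ∧-elim

  InRect? : ∀ ρ r c → Dec (InRect {m} {n} ρ r c)
  InRect? (R , C) r c = (R r ≟ true) ×-dec (C c ≟ true)

  NonEmpty : Rectangle m n → Set
  NonEmpty ρ = Σ (Fin m) λ r → Σ (Fin n) λ c → InRect ρ r c

  nonEmpty? : Decidable NonEmpty
  nonEmpty? ρ = any? λ r → any? λ c → InRect? ρ r c

  rectMatrix-boolRank : ∀ {ρ} → NonEmpty ρ → IsBoolRank (rectMatrix ρ) 1
  rectMatrix-boolRank {ρ} (r , c , rc) =
    (ρ ∷ [] , ((λ _ _ → rectMatrix⁺ ρ) ∷ [] , λ _ _ → here ∘ rectMatrix⁻ ρ) , refl) , atLeastOne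
    where
    atLeastOne : ∀ ρs → IsCover (rectMatrix ρ) ρs → 1 ≤ length ρs
    atLeastOne [] (_ , covers) with covers r c (rectMatrix⁺ ρ rc)
    ... | ()
    atLeastOne (_ ∷ _) _ = s≤s z≤n

  Rectangular : Matrix m n → Set
  Rectangular M = ∀ {r r′ c c′} → M r c′ ≡ true → M r′ c ≡ true → M r c ≡ true

  boolRank1⇒rectangular : ∀ {M} → IsBoolRank M 1 → Rectangular M
  boolRank1⇒rectangular (([] , _ , ()) , _)
  boolRank1⇒rectangular ((_ ∷ _ ∷ _ , _ , ()) , _)
  boolRank1⇒rectangular ((_ ∷ [] , (ones ∷ [] , covers) , refl) , _) e e′
    with covers _ _ e | covers _ _ e′
  ... | here (inR , _) | here (_ , inC) = ones _ _ (inR , inC)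

  support : Matrix m n → Rectangle m n
  support M = (λ r → anyTrue (M r)) , (λ c → anyTrue λ r → M r c)

  support⁺ : ∀ {M r c} → M r c ≡ true → InRect (support M) r c
  support⁺ {M} {r} {c} e = anyTrue⁺ (M r) e , anyTrue⁺ (λ r → M r c) e

  support-AllOnes : ∀ {M} → Rectangular M → AllOnes M (support M)
  support-AllOnes {M} rect r c (inR , inC) =
    rect (proj₂ (anyTrue⁻ (M r) inR)) (proj₂ (anyTrue⁻ (λ r → M r c) inC))

  AllOnes-⪯ : ∀ {M A : Matrix m n} {ρ} → M ⪯ A → AllOnes M ρ → AllOnes A ρ
  AllOnes-⪯ M⪯A ones r c = M⪯A r c ∘ ones r c

  rowRectangle : Matrix m n → Fin m → Rectangle m n
  rowRectangle A r = singleton r , A r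

  rowRectangle-AllOnes : ∀ A r → AllOnes A (rowRectangle A r)
  rowRectangle-AllOnes A r r′ c (inR , inC) = subst (λ x → A x c ≡ true) (singleton-≡ inR) inC

  rowCover : ∀ A → IsCover A (map (rowRectangle A) (allFin m))
  rowCover A =
    All.map⁺ (All.universal (rowRectangle-AllOnes A) (allFin m)) ,
    λ r c e → Any.map⁺ (lose (∈-allFin r) (singleton-refl r , e))

  AllOnes? : ∀ A → Decidable (AllOnes A)
  AllOnes? A ρ = all? λ r → all? λ c → InRect? ρ r c →-dec (A r c ≟ true)

  IsCover? : ∀ A → Decidable (IsCover A)
  IsCover? A ρs =
    All.all? (AllOnes? A) ρs ×-dec
    all? λ r → all? λ c → (A r c ≟ true) →-dec Any.any? (λ ρ → InRect? ρ r c) ρs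

  -- Without function extensionality rectangles cannot be enumerated directly, so
  -- covers are searched among rectangles read off subset vectors; any cover converts.
  fromSubsets : Subset m × Subset n → Rectangle m n
  fromSubsets (R , C) = lookup R , lookup C

  toSubsets : Rectangle m n → Subset m × Subset n
  toSubsets (R , C) = tabulate R , tabulate C

  IsCover-toSubsets : ∀ {A ρs} → IsCover A ρs → IsCover A (map (fromSubsets ∘ toSubsets) ρs)
  IsCover-toSubsets (allOnes , covers) =
    All.map⁺ (All.map (λ ones r c → ones r c ∘ back) allOnes) ,
    λ r c e → Any.map⁺ (Any.map forth (covers r c e))
    where
    back : ∀ {ρ r c} → InRect (fromSubsets (toSubsets ρ)) r c → InRect ρ r c
    back {R , C} {r} {c} (inR , inC) =
      trans (sym (lookup∘tabulate R r)) inR , trans (sym (lookup∘tabulate C c)) inC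
    forth : ∀ {ρ r c} → InRect ρ r c → InRect (fromSubsets (toSubsets ρ)) r c
    forth {R , C} {r} {c} (inR , inC) =
      trans (lookup∘tabulate R r) inR , trans (lookup∘tabulate C c) inC

  HasCoverOfSize : Matrix m n → ℕ → Set
  HasCoverOfSize A k = ∃ λ ρs → IsCover A ρs × length ρs ≡ k

  hasCoverOfSize? : ∀ A → Decidable (HasCoverOfSize A)
  hasCoverOfSize? A k =
    map′ forget remember
      (ofLength? (×-searchable anySubset? anySubset?) k (IsCover? A ∘ map fromSubsets))
    where
    forget : _ → HasCoverOfSize A k
    forget (xs , len , cover) = map fromSubsets xs , cover , trans (length-map _ xs) len
    remember : HasCoverOfSize A k → _
    remember (ρs , cover , len) =
      map toSubsets ρs , trans (length-map _ ρs) len ,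
      subst (IsCover A) (map-∘ ρs) (IsCover-toSubsets cover)

  boolRank-exists : ∀ A → ∃ (IsBoolRank A)
  boolRank-exists A with least (hasCoverOfSize? A) _ (_ , rowCover A , refl)
  ... | b , hasCover , minimal = b , hasCover , λ ρs cover → minimal _ (ρs , cover , refl)

spans⇒derivation : ∀ {U} (sp : Spanoid U) {T i} → Spanoid.Spans sp T i → Derivation sp T i
spans⇒derivation sp {T} {i} spans = step i T id spans (done (here refl))

module _ {m n : ℕ} {A : Matrix m n} where

  rectElement : (ρ : Rectangle m n) → NonEmpty ρ → AllOnes A ρ → UA A
  rectElement ρ nonEmpty ones =
    ⟨ rectMatrix ρ , (rectMatrix-boolRank nonEmpty , λ r c → ones r c ∘ rectMatrix⁻ ρ) ⟩

  support-AllOnes-A : (M : UA A) → AllOnes A (support (mat M))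
  support-AllOnes-A ⟨ M , elem ⟩ r c inRC = recompute (A r c ≟ true)
    (AllOnes-⪯ (proj₂ elem) (support-AllOnes (boolRank1⇒rectangular (proj₁ elem))) r c inRC)

  derivation⇒spans : ∀ {T M} → Derivation (𝒮 A) T M → SpansA T M
  derivation⇒spans (done M∈T) r c e = lose M∈T e
  derivation⇒spans (step _ _ S⊆T spans d) r c e with derivation⇒spans d r c e
  ... | here e′ = Any-resp-⊆ S⊆T (spans r c e′)
  ... | there e′ = e′

  rowElement : ∀ {r c} → A r c ≡ true → UA A
  rowElement {r} {c} e =
    rectElement (rowRectangle A r) (r , c , singleton-refl r , e) (rowRectangle-AllOnes A r)

  spanning⇒cover : ∀ {T} → SpansAll (𝒮 A) T → IsCover A (map (support ∘ mat) T)
  spanning⇒cover {T} spanning =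
    All.map⁺ (All.universal support-AllOnes-A T) ,
    λ r c e → Any.map⁺ (Any.map (λ {N} → support⁺ {M = mat N})
      (derivation⇒spans (spanning (rowElement e)) r c (∧-intro (singleton-refl r) e)))

  -- Empty rectangles are dropped: they do not have Boolean rank 1.
  elements : ∀ ρs → All (AllOnes A) ρs → List (UA A)
  elements [] [] = []
  elements (ρ ∷ ρs) (ones ∷ allOnes) with nonEmpty? ρ
  ... | yes nonEmpty = rectElement ρ nonEmpty ones ∷ elements ρs allOnes
  ... | no _ = elements ρs allOnes

  elements-length : ∀ ρs allOnes → length (elements ρs allOnes) ≤ length ρs
  elements-length [] [] = z≤n
  elements-length (ρ ∷ ρs) (_ ∷ allOnes) with nonEmpty? ρ
  ... | yes _ = s≤s (elements-length ρs allOnes)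
  ... | no _ = m≤n⇒m≤1+n (elements-length ρs allOnes)

  elements-covers : ∀ ρs allOnes {r c} → Any (λ ρ → InRect ρ r c) ρs →
                    Any (λ N → mat N r c ≡ true) (elements ρs allOnes)
  elements-covers (ρ ∷ ρs) (_ ∷ allOnes) inρs with nonEmpty? ρ | inρs
  ... | yes _ | here inρ = here (rectMatrix⁺ ρ inρ)
  ... | yes _ | there inρs′ = there (elements-covers ρs allOnes inρs′)
  ... | no empty | here inρ = contradiction (_ , _ , inρ) empty
  ... | no _ | there inρs′ = elements-covers ρs allOnes inρs′

  cover⇒spanning : ∀ {ρs} (cover : IsCover A ρs) → SpansAll (𝒮 A) (elements ρs (proj₁ cover))
  cover⇒spanning {ρs} (allOnes , covers) ⟨ M , elem ⟩ =
    spans⇒derivation (𝒮 A) λ r c e →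
      elements-covers ρs allOnes (covers r c (recompute (A r c ≟ true) (proj₂ elem r c e)))

  boolRank⇒spanoidRank : ∀ {b} → IsBoolRank A b → IsSpanoidRank (𝒮 A) b
  boolRank⇒spanoidRank ((ρs , cover , refl) , minimal) =
    (_ , spanning , ≤-antisym (elements-length ρs _) (lowerBound _ spanning)) , lowerBound
    where
    spanning : SpansAll (𝒮 A) (elements ρs (proj₁ cover))
    spanning = cover⇒spanning cover
    lowerBound : ∀ T → SpansAll (𝒮 A) T → length ρs ≤ length T
    lowerBound T spansT =
      subst (length ρs ≤_) (length-map _ T) (minimal _ (spanning⇒cover spansT))

proposition1 : ∀ {m n} (A : Matrix m n) →
    Σ ℕ (λ r → IsSpanoidRank (𝒮 A) r × IsBoolRank A r)
proposition1 A with boolRank-exists A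
... | b , isBoolRank = b , boolRank⇒spanoidRank isBoolRank , isBoolRank
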